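{- Let $c\ge1$ and $G\in\mathscr{M}_c$. For any two non-adjacent vertices $v,w$ of $G$ there is a $c$-path covering of $G$ in which both $v$ and $w$ are terminal points of paths. Moreover, a vertex $v$ of $G$ is a terminal point of a path in some $c$-path covering of $G$ if and only if $v$ is not universal.
   Context: All graphs are finite and simple with nonempty vertex set. By convention $K_1$ and $K_2$ are regarded as Hamiltonian (in addition to graphs with a Hamiltonian cycle). $G\ast H$ is the join ($G\sqcup H$ plus all edges between $V(G)$ and $V(H)$); $K_0$ is the empty graph. A vertex $v$ is universal if $\deg(v)=|V(G)|-1$. A path may consist of a single vertex; its terminal points are its endpoints. A $c$-path covering of $G$ is a set of $c$ vertex-disjoint paths in $G$ containing every vertex of $G$. $\check{\mu}(G)=\min\{l\in\mathbb{N}_0: K_l\ast G\text{ is Hamiltonian}\}$. $\mathscr{M}_c$ is the set of graphs $G$ with $\check{\mu}(G)=c$ and $\check{\mu}(G+e)<c$ for every non-edge $e$ of $G$. -}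

module Defs where

open import Data.Nat using (ℕ; zero; suc; _+_; _<_; _≤_)
open import Data.Nat.DivMod using (_mod_)
open import Data.Fin using (Fin; toℕ; splitAt; _≟_)
open import Data.Bool using (Bool; true; false; not; _∧_; _∨_)
open import Data.Sum using (_⊎_; inj₁; inj₂)
open import Data.Product using (Σ; _×_; ∃; ∃-syntax)
open import Data.Maybe using (just)
open import Data.List using (List; []; _∷_; length; concat; head; last)
open import Data.List.Membership.Propositional using (_∈_)
open import Data.List.Relation.Unary.All using (All)
open import Data.List.Relation.Unary.Linked using (Linked)
open import Data.List.Relation.Unary.Unique.Propositional using (Unique)
open import Relation.Nullary using (¬_)
open import Relation.Nullary.Decidable using (⌊_⌋)
open import Relation.Binary.PropositionalEquality using (_≡_; _≢_)
open import Function.Definitions using (Injective)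

Adjacency : ℕ → Set
Adjacency n = Fin n → Fin n → Bool

record Graph : Set where
  field
    n        : ℕ
    nonempty : 1 ≤ n
    adj      : Adjacency n
    sym      : ∀ u v → adj u v ≡ adj v u
    irrefl   : ∀ v → adj v v ≡ false

next : ∀ {m} → Fin m → Fin m
next {suc m} i = suc (toℕ i) mod suc m

-- Hamiltonian: K₁ (one vertex), or at least two vertices and a cyclic
-- ordering σ of all vertices (σ injective on Fin m, hence a bijection)
-- with consecutive vertices adjacent (for m = 2 this means the graph is K₂).
Hamiltonian : (m : ℕ) → Adjacency m → Set
Hamiltonian m A =
  m ≡ 1 ⊎
  (2 ≤ m × Σ (Fin m → Fin m) λ σ →
     Injective _≡_ _≡_ σ × (∀ i → A (σ i) (σ (next i)) ≡ true))

-- Adjacency of the join K_l ∗ G: vertices Fin l (the clique) then Fin n (G)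
joinAdj : (l : ℕ) → ∀ {n} → Adjacency n → Adjacency (l + n)
joinAdj l A i j with splitAt l i | splitAt l j
... | inj₁ a | inj₁ b = not ⌊ a ≟ b ⌋
... | inj₁ _ | inj₂ _ = true
... | inj₂ _ | inj₁ _ = true
... | inj₂ a | inj₂ b = A a b

MuIs : (n : ℕ) → Adjacency n → ℕ → Set
MuIs n A c = Hamiltonian (c + n) (joinAdj c A)
           × (∀ l → l < c → ¬ Hamiltonian (l + n) (joinAdj l A))

addEdge : ∀ {n} → Adjacency n → Fin n → Fin n → Adjacency n
addEdge A u v i j =
  A i j ∨ ((⌊ i ≟ u ⌋ ∧ ⌊ j ≟ v ⌋) ∨ (⌊ i ≟ v ⌋ ∧ ⌊ j ≟ u ⌋))

InM : ℕ → Graph → Set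
InM c G = MuIs n adj c
        × (∀ u v → u ≢ v → adj u v ≡ false →
             ∃[ d ] (MuIs n (addEdge adj u v) d × d < c))
  where open Graph G

-- a path in G: nonempty list of vertices, consecutive ones adjacent
-- (distinctness is imposed globally in PathCovering)
IsPath : (G : Graph) → List (Fin (Graph.n G)) → Set
IsPath G p = (p ≢ []) × Linked (λ x y → Graph.adj G x y ≡ true) p

-- a c-path covering: c paths, pairwise vertex-disjoint, each without repeated
-- vertices (together: the concatenation has no duplicates), covering V(G)
PathCovering : (G : Graph) → ℕ → List (List (Fin (Graph.n G))) → Set
PathCovering G c ps =
  length ps ≡ c × All (IsPath G) ps × Unique (concat ps) × (∀ v → v ∈ concat ps)

Terminal : (G : Graph) → Fin (Graph.n G) → List (List (Fin (Graph.n G))) → Set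
Terminal G v ps = ∃[ p ] (p ∈ ps × (head p ≡ just v ⊎ last p ≡ just v))

Universal : (G : Graph) → Fin (Graph.n G) → Set
Universal G v = ∀ u → u ≢ v → Graph.adj G u v ≡ true

-- For l ≥ 1, K_l ∗ G is Hamiltonian exactly when G can be covered by at most l disjoint
-- paths: the clique vertices cut a Hamiltonian cycle into such paths, and conversely paths
-- can be strung together into a cycle through the clique. So for G ∈ 𝓜_c no covering uses
-- fewer than c paths, while G + vw has one with fewer than c paths (or is Hamiltonian).
-- That covering must use the new edge vw, and deleting it leaves a covering of G by at most
-- c paths in which v and w are endpoints; splitting paths brings their number to exactly c.
-- Conversely, a universal vertex at the end of a path could be joined to another path, or
-- close a Hamiltonian path into a Hamiltonian cycle, contradicting minimality; and a
-- non-universal vertex has a non-neighbour, to which the first part applies.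

module Submission where

open import Defs
open import Data.Bool using (true; false; T; _∧_)
import Data.Bool.Properties as Bool
open import Data.Empty using (⊥; ⊥-elim)
open import Data.Fin as Fin using (Fin; toℕ; _↑ˡ_; _↑ʳ_; splitAt)
import Data.Fin.Properties as Finₚ
open import Data.List using (List; []; _∷_; _++_; length; concat; head; last; lookup; map; tabulate; allFin)
import Data.List.Properties as List
open import Data.List.Membership.Propositional using (_∈_; _∉_)
open import Data.List.Membership.Propositional.Properties
  using (∈-lookup; ∈-++⁺ˡ; ∈-++⁺ʳ; ∈-map⁺; ∈-map⁻; ∈-allFin; ∈-∃++)
open import Data.List.Relation.Unary.Any as Any using (here; there)
open import Data.List.Relation.Unary.Any.Properties using (lookup-index)
open import Data.List.Relation.Unary.All as All using (All; []; _∷_)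
import Data.List.Relation.Unary.All.Properties as All
open import Data.List.Relation.Unary.AllPairs using ([]; _∷_)
open import Data.List.Relation.Unary.Linked as Linked using (Linked; []; [-]; _∷_)
import Data.List.Relation.Unary.Linked.Properties as Linked
open import Data.List.Relation.Unary.Unique.Propositional using (Unique)
import Data.List.Relation.Unary.Unique.Propositional.Properties as Uniqueₚ
open Uniqueₚ using (Unique[x∷xs]⇒x∉xs)
open import Data.List.Relation.Binary.Permutation.Propositional
  using (_↭_; ↭-sym; ↭-trans; ↭-refl; ↭-prep; ↭-reflexive; ↭⇒↭ₛ)
import Data.List.Relation.Binary.Permutation.Propositional.Properties as Perm
import Data.List.Relation.Binary.Permutation.Setoid.Properties as PermSetoid
open import Data.Maybe using (Maybe; just)
import Data.Maybe.Properties as Maybe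
open import Data.Maybe.Relation.Binary.Connected using (Connected; just)
open import Data.Nat as ℕ using (ℕ; zero; suc; _+_; _<_; _≤_; z≤n; s≤s; _%_)
import Data.Nat.Properties as ℕ
open import Data.Nat.DivMod using (m<n⇒m%n≡m; n%n≡0)
open import Data.Product using (_×_; _,_; ∃-syntax; proj₁; proj₂)
open import Data.Sum as Sum using (_⊎_; inj₁; inj₂)
open import Function using (_∘_)
open import Function.Bundles using (Equivalence)
open import Relation.Nullary using (¬_; Dec; yes; no)
open import Relation.Nullary.Decidable using (⌊_⌋; toWitness; _×-dec_; _⊎-dec_)
open import Relation.Binary.PropositionalEquality
  using (_≡_; _≢_; refl; sym; trans; cong; subst; subst₂; setoid)

module _ {X : Set} where

  Endpoint : X → List X → Set
  Endpoint v p = head p ≡ just v ⊎ last p ≡ just v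

  Terminus : X → List (List X) → Set
  Terminus v ps = ∃[ p ] (p ∈ ps × Endpoint v p)

  head-∈ : ∀ (xs : List X) {v} → head xs ≡ just v → v ∈ xs
  head-∈ (x ∷ xs) refl = here refl

  last-∈ : ∀ (xs : List X) {v} → last xs ≡ just v → v ∈ xs
  last-∈ (x ∷ []) refl = here refl
  last-∈ (x ∷ y ∷ xs) eq = there (last-∈ (y ∷ xs) eq)

  last-∷ʳ : ∀ (xs : List X) x → last (xs ++ x ∷ []) ≡ just x
  last-∷ʳ [] x = refl
  last-∷ʳ (y ∷ []) x = refl
  last-∷ʳ (y ∷ z ∷ xs) x = last-∷ʳ (z ∷ xs) x

  last-∷-just : ∀ (x : X) xs → ∃[ z ] last (x ∷ xs) ≡ just z
  last-∷-just x [] = x , refl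
  last-∷-just x (y ∷ xs) = last-∷-just y xs

  ∷ʳ≢[] : ∀ (xs : List X) {x} → xs ++ x ∷ [] ≢ []
  ∷ʳ≢[] [] ()
  ∷ʳ≢[] (_ ∷ _) ()

  ++≢[] : ∀ (xs : List X) {ys} → xs ≢ [] → xs ++ ys ≢ []
  ++≢[] [] xs≢[] = λ _ → xs≢[] refl
  ++≢[] (_ ∷ _) _ = λ ()

  ∷ʳ-view : ∀ (xs : List X) → xs ≢ [] → ∃[ ys ] ∃[ y ] xs ≡ ys ++ y ∷ []
  ∷ʳ-view [] xs≢[] = ⊥-elim (xs≢[] refl)
  ∷ʳ-view (x ∷ []) _ = [] , x , refl
  ∷ʳ-view (x ∷ y ∷ xs) _ with ys , z , eq ← ∷ʳ-view (y ∷ xs) (λ ()) = x ∷ ys , z , cong (x ∷_) eq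

  concat-↭ : ∀ {xss yss : List (List X)} → xss ↭ yss → concat xss ↭ concat yss
  concat-↭ _↭_.refl = ↭-refl
  concat-↭ (_↭_.prep xs p) = Perm.++⁺ˡ xs (concat-↭ p)
  concat-↭ (_↭_.swap xs ys p) = ↭-trans (Perm.shifts xs ys) (Perm.++⁺ˡ ys (Perm.++⁺ˡ xs (concat-↭ p)))
  concat-↭ (_↭_.trans p q) = ↭-trans (concat-↭ p) (concat-↭ q)

  Unique-resp-↭ : ∀ {xs ys : List X} → xs ↭ ys → Unique xs → Unique ys
  Unique-resp-↭ p = PermSetoid.Unique-resp-↭ (setoid X) (↭⇒↭ₛ p)

  Unique-++⁻ˡ : ∀ (xs : List X) {ys} → Unique (xs ++ ys) → Unique xs
  Unique-++⁻ˡ [] _ = []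
  Unique-++⁻ˡ (x ∷ xs) (x∉ ∷ u) = All.++⁻ˡ xs x∉ ∷ Unique-++⁻ˡ xs u

  Unique-++⁻ʳ : ∀ (xs : List X) {ys} → Unique (xs ++ ys) → Unique ys
  Unique-++⁻ʳ [] u = u
  Unique-++⁻ʳ (x ∷ xs) (_ ∷ u) = Unique-++⁻ʳ xs u

  Unique-++⇒disjoint : ∀ (xs : List X) {ys x y} → Unique (xs ++ ys) → x ∈ xs → y ∈ ys → x ≢ y
  Unique-++⇒disjoint (z ∷ xs) (z∉ ∷ _) (here refl) y∈ = All.lookup (All.++⁻ʳ xs z∉) y∈
  Unique-++⇒disjoint (z ∷ xs) (_ ∷ u) (there x∈) y∈ = Unique-++⇒disjoint xs u x∈ y∈

  lookup-injective : ∀ {xs : List X} → Unique xs → ∀ i j → lookup xs i ≡ lookup xs j → i ≡ j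
  lookup-injective (x∉ ∷ u) Fin.zero Fin.zero eq = refl
  lookup-injective (x∉ ∷ u) Fin.zero (Fin.suc j) eq = ⊥-elim (All.lookup x∉ (∈-lookup j) eq)
  lookup-injective (x∉ ∷ u) (Fin.suc i) Fin.zero eq = ⊥-elim (All.lookup x∉ (∈-lookup i) (sym eq))
  lookup-injective (x∉ ∷ u) (Fin.suc i) (Fin.suc j) eq = cong Fin.suc (lookup-injective u i j eq)

  Terminus-mono : ∀ {ps qs : List (List X)} → (∀ {p} → p ∈ ps → p ∈ qs) →
                  ∀ {z} → Terminus z ps → Terminus z qs
  Terminus-mono ps⊆qs (p , p∈ , end) = p , ps⊆qs p∈ , end

  head-++-∷ : ∀ (as : List X) {y} ys → head (as ++ y ∷ ys) ≡ head (as ++ y ∷ [])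
  head-++-∷ [] _ = refl
  head-++-∷ (_ ∷ _) _ = refl

  last-++-∷ : ∀ (as : List X) {y} ys → last (as ++ y ∷ ys) ≡ last (y ∷ ys)
  last-++-∷ [] _ = refl
  last-++-∷ (_ ∷ []) _ = refl
  last-++-∷ (_ ∷ a ∷ as) ys = last-++-∷ (a ∷ as) ys

  Unique-prefix≡[] : ∀ (as : List X) {ys y} → Unique (as ++ ys) → head (as ++ ys) ≡ just y →
                     y ∈ ys → as ≡ []
  Unique-prefix≡[] [] _ _ _ = refl
  Unique-prefix≡[] (a ∷ as) u refl y∈ys = ⊥-elim (Unique-++⇒disjoint (a ∷ as) u (here refl) y∈ys refl)

  Unique-suffix≡[] : ∀ (ys : List X) {bs y} → Unique (ys ++ bs) → last (ys ++ bs) ≡ just y →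
                     y ∈ ys → bs ≡ []
  Unique-suffix≡[] ys {[]} _ _ _ = refl
  Unique-suffix≡[] ys {b ∷ bs} u final y∈ys =
    ⊥-elim (Unique-++⇒disjoint ys u y∈ys (last-∈ (b ∷ bs) (trans (sym (last-++-∷ ys bs)) final)) refl)

  last≢head : ∀ {x y : X} {ys z} → Unique (x ∷ y ∷ ys) → last (y ∷ ys) ≡ just z → z ≢ x
  last≢head {ys = ys} (x∉ ∷ _) final refl = All.lookup x∉ (last-∈ (_ ∷ ys) final) refl

module _ {X : Set} {R : X → X → Set} where

  Linked-splitAt : ∀ (xs : List X) {y ys} → Linked R (xs ++ y ∷ ys) →
                   Linked R (xs ++ y ∷ []) × Linked R (y ∷ ys)
  Linked-splitAt [] l = [-] , l
  Linked-splitAt (x ∷ []) (r ∷ l) = r ∷ [-] , l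
  Linked-splitAt (x ∷ x′ ∷ xs) (r ∷ l) with l₁ , l₂ ← Linked-splitAt (x′ ∷ xs) l = r ∷ l₁ , l₂

  Linked-glue : ∀ (xs : List X) {y ys} → Linked R (xs ++ y ∷ []) → Linked R (y ∷ ys) →
                Linked R (xs ++ y ∷ ys)
  Linked-glue [] _ l = l
  Linked-glue (x ∷ []) (r ∷ _) l = r ∷ l
  Linked-glue (x ∷ x′ ∷ xs) (r ∷ l₁) l₂ = r ∷ Linked-glue (x′ ∷ xs) l₁ l₂

  Linked-++⁻ˡ : ∀ (xs : List X) {ys} → Linked R (xs ++ ys) → Linked R xs
  Linked-++⁻ˡ [] _ = []
  Linked-++⁻ˡ (x ∷ []) _ = [-]
  Linked-++⁻ˡ (x ∷ x′ ∷ xs) (r ∷ l) = r ∷ Linked-++⁻ˡ (x′ ∷ xs) l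

  Linked-rotate : ∀ x xs y ys → Linked R (x ∷ (xs ++ y ∷ ys) ++ x ∷ []) →
                  Linked R (y ∷ (ys ++ x ∷ xs) ++ y ∷ [])
  Linked-rotate x xs y ys l
    with l₁ , l₂ ← Linked-splitAt (x ∷ xs)
                     (subst (Linked R) (cong (x ∷_) (List.++-assoc xs (y ∷ ys) (x ∷ []))) l)
    = subst (Linked R) (cong (y ∷_) (sym (List.++-assoc ys (x ∷ xs) (y ∷ []))))
        (Linked-glue (y ∷ ys) l₂ l₁)

  Linked-++⁺-edge : ∀ {xs ys x y} → Linked R xs → last xs ≡ just x → R x y → head ys ≡ just y →
                    Linked R ys → Linked R (xs ++ ys)
  Linked-++⁺-edge lx final r first ly = Linked.++⁺ lx (subst₂ (Connected R) (sym final) (sym first) (just r)) ly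

  Linked-∷ʳ⁻ : ∀ x xs {y} → Linked R ((x ∷ xs) ++ y ∷ []) →
               Linked R (x ∷ xs) × ∃[ z ] (last (x ∷ xs) ≡ just z × R z y)
  Linked-∷ʳ⁻ x [] (r ∷ _) = [-] , x , refl , r
  Linked-∷ʳ⁻ x (x′ ∷ xs) (r ∷ l) with l′ , z , final , r′ ← Linked-∷ʳ⁻ x′ xs l = r ∷ l′ , z , final , r′

  Linked-tabulate-∷ʳ : ∀ k (f : Fin (suc k) → X) {z} →
    (∀ i → R (f (Fin.inject₁ i)) (f (Fin.suc i))) → R (f (Fin.fromℕ k)) z →
    Linked R (tabulate f ++ z ∷ [])
  Linked-tabulate-∷ʳ zero f _ r = r ∷ [-]
  Linked-tabulate-∷ʳ (suc k) f steps r =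
    steps Fin.zero ∷ Linked-tabulate-∷ʳ k (f ∘ Fin.suc) (steps ∘ Fin.suc) r

  Linked-lookup : ∀ (ys : List X) {z} → Linked R (ys ++ z ∷ []) → ∀ (i j : Fin (length ys)) →
                  suc (toℕ i) ≡ toℕ j → R (lookup ys i) (lookup ys j)
  Linked-lookup (y ∷ y′ ∷ ys) (r ∷ _) Fin.zero (Fin.suc Fin.zero) _ = r
  Linked-lookup (y ∷ ys) l (Fin.suc i) (Fin.suc j) eq =
    Linked-lookup ys (Linked.tail l) i j (ℕ.suc-injective eq)
  Linked-lookup (y ∷ y′ ∷ ys) _ Fin.zero (Fin.suc (Fin.suc j)) ()
  Linked-lookup (y ∷ []) _ Fin.zero (Fin.suc ()) _

  Linked-lookup-last : ∀ (ys : List X) {z} → Linked R (ys ++ z ∷ []) → ∀ (i : Fin (length ys)) →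
                       suc (toℕ i) ≡ length ys → R (lookup ys i) z
  Linked-lookup-last (y ∷ []) (r ∷ _) Fin.zero _ = r
  Linked-lookup-last (y ∷ ys) l (Fin.suc i) eq = Linked-lookup-last ys (Linked.tail l) i (ℕ.suc-injective eq)
  Linked-lookup-last (y ∷ y′ ∷ ys) _ Fin.zero ()

-- Enumerations of Fin n and Hamiltonian cycles

module _ {n : ℕ} where

  Enumerates : List (Fin n) → Set
  Enumerates xs = Unique xs × (∀ v → v ∈ xs)

  Unique⇒length≤ : ∀ {xs} → Unique xs → length xs ≤ n
  Unique⇒length≤ u = Finₚ.injective⇒≤ (λ {i} {j} → lookup-injective u i j)

  covers⇒length≥ : ∀ {xs} → (∀ v → v ∈ xs) → n ≤ length xs
  covers⇒length≥ {xs} cover = Finₚ.injective⇒≤ {f = λ v → Any.index (cover v)} injective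
    where
    injective : ∀ {u v} → Any.index (cover u) ≡ Any.index (cover v) → u ≡ v
    injective {u} {v} eq =
      trans (lookup-index (cover u)) (trans (cong (lookup xs) eq) (sym (lookup-index (cover v))))

  Enumerates⇒length≡ : ∀ {xs} → Enumerates xs → length xs ≡ n
  Enumerates⇒length≡ (u , cover) = ℕ.≤-antisym (Unique⇒length≤ u) (covers⇒length≥ cover)

  Unique⇒Enumerates : ∀ {xs} → Unique xs → n ≤ length xs → Enumerates xs
  Unique⇒Enumerates {xs} u n≤ = u , cover
    where
    open import Data.List.Membership.DecPropositional (Fin._≟_ {n}) using (_∈?_)
    cover : ∀ v → v ∈ xs
    cover v with v ∈? xs
    ... | yes v∈ = v∈
    ... | no v∉ = ⊥-elim (ℕ.<-irrefl refl (ℕ.≤-trans (Unique⇒length≤ (All.¬Any⇒All¬ xs v∉ ∷ u)) n≤))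

  Enumerates-resp-↭ : ∀ {xs ys} → xs ↭ ys → Enumerates xs → Enumerates ys
  Enumerates-resp-↭ p (u , cover) = Unique-resp-↭ p u , λ v → Perm.∈-resp-↭ p (cover v)

Edge : ∀ {n} → Adjacency n → Fin n → Fin n → Set
Edge A x y = A x y ≡ true

HamCycle : ∀ {n} → Adjacency n → Set
HamCycle A = ∃[ x ] ∃[ xs ] (Enumerates (x ∷ xs) × Linked (Edge A) (x ∷ xs ++ x ∷ []))

toℕ-next : ∀ {k} (i : Fin (suc k)) → toℕ (next i) ≡ suc (toℕ i) % suc k
toℕ-next i = Finₚ.toℕ-fromℕ< _

next-inject₁ : ∀ {k} (i : Fin k) → next (Fin.inject₁ i) ≡ Fin.suc i
next-inject₁ {k} i = Finₚ.toℕ-injective (trans (toℕ-next (Fin.inject₁ i))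
  (trans (cong (λ t → suc t % suc k) (Finₚ.toℕ-inject₁ i)) (m<n⇒m%n≡m (s≤s (Finₚ.toℕ<n i)))))

next-fromℕ : ∀ k → next (Fin.fromℕ k) ≡ Fin.zero
next-fromℕ k = Finₚ.toℕ-injective (trans (toℕ-next (Fin.fromℕ k))
  (trans (cong (λ t → suc t % suc k) (Finₚ.toℕ-fromℕ k)) (n%n≡0 (suc k))))

hamiltonian⇒cycle : ∀ m (A : Adjacency m) → Hamiltonian m A → m ≡ 1 ⊎ HamCycle A
hamiltonian⇒cycle m A (inj₁ m≡1) = inj₁ m≡1
hamiltonian⇒cycle (suc k) A (inj₂ (_ , σ , σ-injective , steps)) =
  inj₂ (σ Fin.zero , tabulate (σ ∘ Fin.suc) ,
        Unique⇒Enumerates (Uniqueₚ.tabulate⁺ σ-injective) (ℕ.≤-reflexive (sym (List.length-tabulate σ))) ,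
        Linked-tabulate-∷ʳ k σ
          (λ i → subst (Edge A (σ (Fin.inject₁ i)) ∘ σ) (next-inject₁ i) (steps (Fin.inject₁ i)))
          (subst (Edge A (σ (Fin.fromℕ k)) ∘ σ) (next-fromℕ k) (steps (Fin.fromℕ k))))

cycle⇒hamiltonian : ∀ m (A : Adjacency m) → 2 ≤ m → HamCycle A → Hamiltonian m A
cycle⇒hamiltonian (suc k) A 2≤m (x , xs , enum , cycle) = inj₂ (2≤m , σ , σ-injective , steps)
  where
  L = x ∷ xs
  len : length L ≡ suc k
  len = Enumerates⇒length≡ enum
  idx : Fin (suc k) → Fin (length L)
  idx = Fin.cast (sym len)
  toℕ-idx : ∀ i → toℕ (idx i) ≡ toℕ i
  toℕ-idx = Finₚ.toℕ-cast (sym len)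
  σ : Fin (suc k) → Fin (suc k)
  σ i = lookup L (idx i)
  σ-injective : ∀ {i j} → σ i ≡ σ j → i ≡ j
  σ-injective {i} {j} eq = Finₚ.toℕ-injective
    (trans (sym (toℕ-idx i))
      (trans (cong toℕ (lookup-injective (proj₁ enum) (idx i) (idx j) eq)) (toℕ-idx j)))
  steps : ∀ i → Edge A (σ i) (σ (next i))
  steps i with suc (toℕ i) ℕ.<? suc k
  ... | yes i+1<m = Linked-lookup L cycle (idx i) (idx (next i))
        (trans (cong suc (toℕ-idx i))
          (sym (trans (toℕ-idx (next i)) (trans (toℕ-next i) (m<n⇒m%n≡m i+1<m)))))
  ... | no i+1≮m = subst (Edge A (σ i) ∘ lookup L) (sym next-idx≡0)
        (Linked-lookup-last L cycle (idx i) (trans (cong suc (toℕ-idx i)) (trans i+1≡m (sym len))))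
    where
    i+1≡m : suc (toℕ i) ≡ suc k
    i+1≡m = ℕ.≤-antisym (Finₚ.toℕ<n i) (ℕ.≮⇒≥ i+1≮m)
    next-idx≡0 : idx (next i) ≡ Fin.zero
    next-idx≡0 = Finₚ.toℕ-injective
      (trans (toℕ-idx (next i)) (trans (toℕ-next i) (trans (cong (_% suc k) i+1≡m) (n%n≡0 (suc k)))))

module _ {n} {A : Adjacency n} where

  HamCycle-from : HamCycle A → ∀ y →
                  ∃[ ys ] (Enumerates (y ∷ ys) × Linked (Edge A) (y ∷ ys ++ y ∷ []))
  HamCycle-from (x , xs , enum@(_ , cover) , cycle) y with cover y
  ... | here refl = xs , enum , cycle
  ... | there y∈xs with as , bs , refl ← ∈-∃++ y∈xs =
    bs ++ x ∷ as , Enumerates-resp-↭ (Perm.++-comm (x ∷ as) (y ∷ bs)) enum , Linked-rotate x as y bs cycle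

-- Path coverings

Path : ∀ {n} → Adjacency n → List (Fin n) → Set
Path A p = p ≢ [] × Linked (Edge A) p

Covering : ∀ {n} → Adjacency n → List (List (Fin n)) → Set
Covering A ps = All (Path A) ps × Enumerates (concat ps)

module _ {n} {A : Adjacency n} where

  Covering-resp-↭ : ∀ {ps qs} → ps ↭ qs → Covering A ps → Covering A qs
  Covering-resp-↭ p (paths , enum) = Perm.All-resp-↭ p paths , Enumerates-resp-↭ (concat-↭ p) enum

  Covering-cong : ∀ {ps qs} → concat qs ≡ concat ps → All (Path A) qs → Covering A ps → Covering A qs
  Covering-cong eq paths (_ , enum) = paths , subst Enumerates (sym eq) enum

  Covering⇒nonempty : 1 ≤ n → ∀ {ps} → Covering A ps → 1 ≤ length ps
  Covering⇒nonempty 1≤n {[]} (_ , _ , cover) with cover (Fin.fromℕ< 1≤n)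
  ... | ()
  Covering⇒nonempty _ {_ ∷ _} _ = s≤s z≤n

  singletons-covering : Covering A (map (_∷ []) (allFin n))
  singletons-covering = paths (allFin n) ,
    subst Enumerates (sym (concat-singletons (allFin n))) (Uniqueₚ.allFin⁺ n , ∈-allFin)
    where
    paths : ∀ xs → All (Path A) (map (_∷ []) xs)
    paths [] = []
    paths (x ∷ xs) = ((λ ()) , [-]) ∷ paths xs
    concat-singletons : ∀ (xs : List (Fin n)) → concat (map (_∷ []) xs) ≡ xs
    concat-singletons [] = refl
    concat-singletons (x ∷ xs) = cong (x ∷_) (concat-singletons xs)

  split-path : ∀ ps → All (Path A) ps → length ps < length (concat ps) →
    ∃[ qs ] (All (Path A) qs × concat qs ≡ concat ps × length qs ≡ suc (length ps)
             × (∀ {z} → Terminus z ps → Terminus z qs))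
  split-path ([] ∷ _) ((p≢[] , _) ∷ _) _ = ⊥-elim (p≢[] refl)
  split-path ((x ∷ []) ∷ ps) (path ∷ paths) (s≤s lt)
    with qs , paths′ , eq , len , termini ← split-path ps paths lt =
    (x ∷ []) ∷ qs , path ∷ paths′ , cong (x ∷_) eq , cong suc len , termini′
    where
    termini′ : ∀ {z} → Terminus z ((x ∷ []) ∷ ps) → Terminus z ((x ∷ []) ∷ qs)
    termini′ (_ , here refl , end) = _ , here refl , end
    termini′ (p , there p∈ , end) = Terminus-mono there (termini (p , p∈ , end))
  split-path ((x ∷ y ∷ p) ∷ ps) ((_ , _ ∷ l) ∷ paths) _ =
    (x ∷ []) ∷ (y ∷ p) ∷ ps , ((λ ()) , [-]) ∷ ((λ ()) , l) ∷ paths , refl , refl , termini′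
    where
    termini′ : ∀ {z} → Terminus z ((x ∷ y ∷ p) ∷ ps) → Terminus z ((x ∷ []) ∷ (y ∷ p) ∷ ps)
    termini′ (_ , here refl , inj₁ first) = _ , here refl , inj₁ first
    termini′ (_ , here refl , inj₂ final) = _ , there (here refl) , inj₂ final
    termini′ (q , there q∈ , end) = q , there (there q∈) , end

  Covering-refine : ∀ k ps → length ps + k ≤ n → Covering A ps →
    ∃[ qs ] (Covering A qs × length qs ≡ length ps + k × (∀ {z} → Terminus z ps → Terminus z qs))
  Covering-refine zero ps _ cov = ps , cov , sym (ℕ.+-identityʳ _) , λ t → t
  Covering-refine (suc k) ps ≤n cov@(paths , enum)
    with qs , paths′ , eq , len , termini ← split-path ps paths
           (subst (length ps <_) (sym (Enumerates⇒length≡ (proj₂ cov)))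
             (ℕ.<-≤-trans (ℕ.m<m+n (length ps) {suc k} (s≤s z≤n)) ≤n))
    with rs , cov′ , len′ , termini′ ←
           Covering-refine k qs (subst (_≤ n) (trans (ℕ.+-suc _ k) (cong (_+ k) (sym len))) ≤n)
             (Covering-cong eq paths′ cov)
    = rs , cov′ , trans len′ (trans (cong (_+ k) len) (sym (ℕ.+-suc _ k))) , termini′ ∘ termini

-- Joins with a clique

module Join (d n : ℕ) where

  clique : Fin d → Fin (d + n)
  clique i = i ↑ˡ n

  vertex : Fin n → Fin (d + n)
  vertex v = d ↑ʳ v

  data View : Fin (d + n) → Set where
    clique-view : ∀ i → View (clique i)
    vertex-view : ∀ v → View (vertex v)

  view : ∀ x → View x
  view x with splitAt d x in eq
  ... | inj₁ i = subst View (Finₚ.splitAt⁻¹-↑ˡ eq) (clique-view i)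
  ... | inj₂ v = subst View (Finₚ.splitAt⁻¹-↑ʳ eq) (vertex-view v)

  clique≢vertex : ∀ i v → clique i ≢ vertex v
  clique≢vertex i v eq
    with () ← trans (sym (Finₚ.splitAt-↑ˡ d i n)) (trans (cong (splitAt d) eq) (Finₚ.splitAt-↑ʳ d n v))

  clique-injective : ∀ {i j} → clique i ≡ clique j → i ≡ j
  clique-injective {i} {j} = Finₚ.↑ˡ-injective n i j

  vertex-injective : ∀ {u v} → vertex u ≡ vertex v → u ≡ v
  vertex-injective {u} {v} = Finₚ.↑ʳ-injective d u v

  module _ (A : Adjacency n) where

    joinAdj-clique-vertex : ∀ i v → joinAdj d A (clique i) (vertex v) ≡ true
    joinAdj-clique-vertex i v rewrite Finₚ.splitAt-↑ˡ d i n | Finₚ.splitAt-↑ʳ d n v = refl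

    joinAdj-vertex-clique : ∀ v i → joinAdj d A (vertex v) (clique i) ≡ true
    joinAdj-vertex-clique v i rewrite Finₚ.splitAt-↑ˡ d i n | Finₚ.splitAt-↑ʳ d n v = refl

    joinAdj-vertex-vertex : ∀ u v → joinAdj d A (vertex u) (vertex v) ≡ A u v
    joinAdj-vertex-vertex u v rewrite Finₚ.splitAt-↑ʳ d n u | Finₚ.splitAt-↑ʳ d n v = refl

  graphPart : List (Fin (d + n)) → List (Fin n)
  graphPart [] = []
  graphPart (x ∷ xs) with view x
  ... | clique-view _ = graphPart xs
  ... | vertex-view v = v ∷ graphPart xs

  cliquePart : List (Fin (d + n)) → List (Fin d)
  cliquePart [] = []
  cliquePart (x ∷ xs) with view x
  ... | clique-view i = i ∷ cliquePart xs
  ... | vertex-view _ = cliquePart xs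

  graphPart⁻ : ∀ xs {v} → v ∈ graphPart xs → vertex v ∈ xs
  graphPart⁻ (x ∷ xs) v∈ with view x
  ... | clique-view _ = there (graphPart⁻ xs v∈)
  graphPart⁻ (x ∷ xs) (here refl) | vertex-view _ = here refl
  graphPart⁻ (x ∷ xs) (there v∈) | vertex-view _ = there (graphPart⁻ xs v∈)

  graphPart⁺ : ∀ xs {v} → vertex v ∈ xs → v ∈ graphPart xs
  graphPart⁺ (x ∷ xs) v∈ with view x
  graphPart⁺ (x ∷ xs) (here eq) | clique-view i = ⊥-elim (clique≢vertex i _ (sym eq))
  graphPart⁺ (x ∷ xs) (there v∈) | clique-view _ = graphPart⁺ xs v∈
  graphPart⁺ (x ∷ xs) (here eq) | vertex-view _ = here (vertex-injective eq)
  graphPart⁺ (x ∷ xs) (there v∈) | vertex-view _ = there (graphPart⁺ xs v∈)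

  cliquePart⁻ : ∀ xs {i} → i ∈ cliquePart xs → clique i ∈ xs
  cliquePart⁻ (x ∷ xs) i∈ with view x
  cliquePart⁻ (x ∷ xs) (here refl) | clique-view _ = here refl
  cliquePart⁻ (x ∷ xs) (there i∈) | clique-view _ = there (cliquePart⁻ xs i∈)
  ... | vertex-view _ = there (cliquePart⁻ xs i∈)

  graphPart-Unique : ∀ {xs} → Unique xs → Unique (graphPart xs)
  graphPart-Unique {[]} _ = []
  graphPart-Unique {x ∷ xs} (x∉ ∷ u) with view x
  ... | clique-view _ = graphPart-Unique u
  ... | vertex-view _ =
    All.tabulate (λ v∈ eq → All.lookup x∉ (graphPart⁻ xs v∈) (cong vertex eq)) ∷ graphPart-Unique u

  cliquePart-Unique : ∀ {xs} → Unique xs → Unique (cliquePart xs)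
  cliquePart-Unique {[]} _ = []
  cliquePart-Unique {x ∷ xs} (x∉ ∷ u) with view x
  ... | clique-view _ =
    All.tabulate (λ i∈ eq → All.lookup x∉ (cliquePart⁻ xs i∈) (cong clique eq)) ∷ cliquePart-Unique u
  ... | vertex-view _ = cliquePart-Unique u

  module _ (A : Adjacency n) where

    -- lead is the run of graph vertices before the first clique vertex.
    record Runs (vertices : List (Fin n)) (cliques : List (Fin d)) (start : Maybe (Fin (d + n))) : Set where
      constructor mkRuns
      field
        lead        : List (Fin n)
        runs        : List (List (Fin n))
        lead-linked : Linked (Edge A) lead
        runs-paths  : All (Path A) runs
        partition   : lead ++ concat runs ≡ vertices
        count       : length runs ≤ length cliques
        lead-start  : ∀ {u us} → lead ≡ u ∷ us → start ≡ just (vertex u)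

    split-runs : ∀ xs → Linked (Edge (joinAdj d A)) xs → Runs (graphPart xs) (cliquePart xs) (head xs)
    split-runs [] _ = mkRuns [] [] [] [] refl z≤n λ ()
    split-runs (x ∷ xs) l with view x | split-runs xs (Linked.tail l)
    ... | clique-view i | mkRuns [] rs _ paths eq count _ =
      mkRuns [] rs [] paths eq (ℕ.m≤n⇒m≤1+n count) λ ()
    ... | clique-view i | mkRuns (u ∷ us) rs lead paths eq count _ =
      mkRuns [] ((u ∷ us) ∷ rs) [] (((λ ()) , lead) ∷ paths) eq (s≤s count) λ ()
    ... | vertex-view v | mkRuns [] rs _ paths eq count _ =
      mkRuns (v ∷ []) rs [-] paths (cong (v ∷_) eq) count λ { refl → refl }
    ... | vertex-view v | mkRuns (u ∷ us) rs lead paths eq count start =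
      mkRuns (v ∷ u ∷ us) rs (edge (start refl) l ∷ lead) paths (cong (v ∷_) eq) count λ { refl → refl }
      where
      edge : ∀ {ys} → head ys ≡ just (vertex u) → Linked (Edge (joinAdj d A)) (vertex v ∷ ys) → Edge A v u
      edge {_ ∷ _} refl (e ∷ _) = trans (sym (joinAdj-vertex-vertex A v u)) e

  graphPart-Enumerates : ∀ {xs} → Enumerates xs → Enumerates (graphPart xs)
  graphPart-Enumerates {xs} (u , cover) = graphPart-Unique u , λ v → graphPart⁺ xs (cover (vertex v))

  interleave : List (Fin d) → List (List (Fin n)) → List (Fin (d + n))
  interleave (i ∷ is) (p ∷ ps) = clique i ∷ map vertex p ++ interleave is ps
  interleave _ _ = []

  interleave-↭ : ∀ is ps → length is ≡ length ps →
                 interleave is ps ↭ map clique is ++ map vertex (concat ps)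
  interleave-↭ [] [] _ = ↭-refl
  interleave-↭ (i ∷ is) (p ∷ ps) eq =
    ↭-prep (clique i) (↭-trans (Perm.++⁺ˡ (map vertex p) (interleave-↭ is ps (ℕ.suc-injective eq)))
      (↭-trans (Perm.shifts (map vertex p) (map clique is))
        (Perm.++⁺ˡ (map clique is) (↭-reflexive (sym (List.map-++ vertex p (concat ps)))))))

  module _ (A : Adjacency n) where

    interleave-∷ʳ-starts-at-clique : ∀ is ps j →
                                     ∃[ i ] head (interleave is ps ++ clique j ∷ []) ≡ just (clique i)
    interleave-∷ʳ-starts-at-clique (i ∷ is) (p ∷ ps) j = i , refl
    interleave-∷ʳ-starts-at-clique [] ps j = j , refl
    interleave-∷ʳ-starts-at-clique (i ∷ is) [] j = j , refl

    vertices-then-clique : ∀ u us rest → Linked (Edge A) (u ∷ us) → Linked (Edge (joinAdj d A)) rest →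
      ∃[ i ] head rest ≡ just (clique i) → Linked (Edge (joinAdj d A)) (vertex u ∷ map vertex us ++ rest)
    vertices-then-clique u [] (_ ∷ _) _ l (i , refl) = joinAdj-vertex-clique A u i ∷ l
    vertices-then-clique u (u′ ∷ us) rest (e ∷ lu) l start =
      trans (joinAdj-vertex-vertex A u u′) e ∷ vertices-then-clique u′ us rest lu l start

    interleave-linked : ∀ is ps j → All (Path A) ps →
                        Linked (Edge (joinAdj d A)) (interleave is ps ++ clique j ∷ [])
    interleave-linked [] ps j _ = [-]
    interleave-linked (i ∷ is) [] j _ = [-]
    interleave-linked (i ∷ is) ([] ∷ ps) j ((p≢[] , _) ∷ _) = ⊥-elim (p≢[] refl)
    interleave-linked (i ∷ is) ((u ∷ us) ∷ ps) j ((_ , lp) ∷ paths) =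
      subst (Linked (Edge (joinAdj d A)) ∘ (clique i ∷_))
        (sym (List.++-assoc (map vertex (u ∷ us)) (interleave is ps) (clique j ∷ [])))
        (joinAdj-clique-vertex A i u ∷ vertices-then-clique u us _ lp
          (interleave-linked is ps j paths) (interleave-∷ʳ-starts-at-clique is ps j))

module _ (d : ℕ) {n} (A : Adjacency n) (1≤n : 1 ≤ n) where
  open Join (suc d) n

  -- Started at a clique vertex, the Hamiltonian cycle splits into maximal runs of graph
  -- vertices, each preceded by its own clique vertex.
  hamiltonian-join⇒covering : Hamiltonian (suc d + n) (joinAdj (suc d) A) →
                              ∃[ ps ] (Covering A ps × length ps ≤ suc d)
  hamiltonian-join⇒covering ham with hamiltonian⇒cycle (suc d + n) (joinAdj (suc d) A) ham
  ... | inj₁ m≡1 = ⊥-elim (ℕ.<-irrefl (sym (ℕ.m+n≡0⇒n≡0 d (ℕ.suc-injective m≡1))) 1≤n)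
  ... | inj₂ cycle
    with ys , enum , l ← HamCycle-from cycle (clique Fin.zero)
    with split-runs A (clique Fin.zero ∷ ys) (Linked-++⁻ˡ (clique Fin.zero ∷ ys) l)
  ... | mkRuns (u ∷ _) _ _ _ _ _ start = ⊥-elim (clique≢vertex Fin.zero u (Maybe.just-injective (start refl)))
  ... | mkRuns [] runs _ paths partition count _ =
    runs , (paths , subst Enumerates (sym partition) (graphPart-Enumerates enum)) ,
    ℕ.≤-trans count (Unique⇒length≤ (cliquePart-Unique (proj₁ enum)))

-- The cycle clique₀ p₀ clique₁ p₁ … back to clique₀, for the paths p₀, p₁, … of the covering.
covering⇒hamiltonian-join : ∀ {n} (A : Adjacency n) → 1 ≤ n → ∀ {ps} → Covering A ps →
                            Hamiltonian (length ps + n) (joinAdj (length ps) A)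
covering⇒hamiltonian-join A 1≤n {[]} cov = ⊥-elim (ℕ.<-irrefl refl (Covering⇒nonempty 1≤n cov))
covering⇒hamiltonian-join {n} A 1≤n {p ∷ ps} cov@(paths , enum) =
  cycle⇒hamiltonian (d + n) (joinAdj d A) (s≤s (ℕ.≤-trans 1≤n (ℕ.m≤n+m n (length ps))))
    (clique Fin.zero , map vertex p ++ interleave (tabulate Fin.suc) ps ,
     Enumerates-resp-↭ (↭-sym perm) (unique , cover) ,
     interleave-linked A (allFin d) (p ∷ ps) Fin.zero paths)
  where
  d = suc (length ps)
  open Join d n
  perm : interleave (allFin d) (p ∷ ps) ↭ map clique (allFin d) ++ map vertex (concat (p ∷ ps))
  perm = interleave-↭ (allFin d) (p ∷ ps) (List.length-tabulate (λ i → i))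
  unique : Unique (map clique (allFin d) ++ map vertex (concat (p ∷ ps)))
  unique = Uniqueₚ.++⁺ (Uniqueₚ.map⁺ clique-injective (Uniqueₚ.allFin⁺ d))
                       (Uniqueₚ.map⁺ vertex-injective (proj₁ enum))
    λ (x∈cliques , x∈vertices) → disjoint (∈-map⁻ clique x∈cliques) (∈-map⁻ vertex x∈vertices)
    where
    disjoint : ∀ {x} → ∃[ i ] (i ∈ allFin d × x ≡ clique i) →
               ∃[ v ] (v ∈ concat (p ∷ ps) × x ≡ vertex v) → ⊥
    disjoint (i , _ , refl) (v , _ , eq) = clique≢vertex i v eq
  cover : ∀ x → x ∈ map clique (allFin d) ++ map vertex (concat (p ∷ ps))
  cover x with view x
  ... | clique-view i = ∈-++⁺ˡ (∈-map⁺ clique (∈-allFin i))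
  ... | vertex-view v = ∈-++⁺ʳ (map clique (allFin d)) (∈-map⁺ vertex (proj₂ enum v))

-- Adding an edge

module AddEdge {n} (A : Adjacency n) (v w : Fin n) where

  A⁺ : Adjacency n
  A⁺ = addEdge A v w

  New : Fin n → Fin n → Set
  New x y = (x ≡ v × y ≡ w) ⊎ (x ≡ w × y ≡ v)

  OnNew : Fin n → Set
  OnNew z = z ≡ v ⊎ z ≡ w

  New? : ∀ x y → Dec (New x y)
  New? x y = ((x Fin.≟ v) ×-dec (y Fin.≟ w)) ⊎-dec ((x Fin.≟ w) ×-dec (y Fin.≟ v))

  Edge-addEdge : ∀ {x y} → Edge A⁺ x y → Edge A x y ⊎ New x y
  Edge-addEdge {x} {y} e with Equivalence.to Bool.T-∨ (Equivalence.from Bool.T-≡ e)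
  ... | inj₁ t = inj₁ (Equivalence.to Bool.T-≡ t)
  ... | inj₂ t = inj₂ (Sum.map (witnesses (x Fin.≟ v) (y Fin.≟ w)) (witnesses (x Fin.≟ w) (y Fin.≟ v))
                               (Equivalence.to Bool.T-∨ t))
    where
    witnesses : ∀ {P Q : Set} (p? : Dec P) (q? : Dec Q) → T (⌊ p? ⌋ ∧ ⌊ q? ⌋) → P × Q
    witnesses p? q? t with tp , tq ← Equivalence.to (Bool.T-∧ {⌊ p? ⌋} {⌊ q? ⌋}) t =
      toWitness {a? = p?} tp , toWitness {a? = q?} tq

  Edge-addEdge-old : ∀ {x y} → Edge A⁺ x y → ¬ New x y → Edge A x y
  Edge-addEdge-old e ¬new with Edge-addEdge e
  ... | inj₁ old = old
  ... | inj₂ new = ⊥-elim (¬new new)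

  New-source : ∀ {x y} → New x y → OnNew x
  New-source (inj₁ (x≡v , _)) = inj₁ x≡v
  New-source (inj₂ (x≡w , _)) = inj₂ x≡w

  New-target : ∀ {x y} → New x y → OnNew y
  New-target (inj₁ (_ , y≡w)) = inj₂ y≡w
  New-target (inj₂ (_ , y≡v)) = inj₁ y≡v

  New-covers : ∀ {x y z} → New x y → OnNew z → z ∈ x ∷ y ∷ []
  New-covers (inj₁ (refl , refl)) (inj₁ refl) = here refl
  New-covers (inj₁ (refl , refl)) (inj₂ refl) = there (here refl)
  New-covers (inj₂ (refl , refl)) (inj₁ refl) = there (here refl)
  New-covers (inj₂ (refl , refl)) (inj₂ refl) = here refl

  New-termini : ∀ {x y ps} → New x y → Terminus x ps → Terminus y ps → Terminus v ps × Terminus w ps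
  New-termini (inj₁ (refl , refl)) tx ty = tx , ty
  New-termini (inj₂ (refl , refl)) tx ty = ty , tx

  Linked-avoiding : ∀ {z} → OnNew z → ∀ {q} → z ∉ q → Linked (Edge A⁺) q → Linked (Edge A) q
  Linked-avoiding _ _ [] = []
  Linked-avoiding _ _ [-] = [-]
  Linked-avoiding z-on z∉ (e ∷ l) = Edge-addEdge-old e ¬new ∷ Linked-avoiding z-on (z∉ ∘ there) l
    where
    ¬new : ¬ New _ _
    ¬new new with New-covers new z-on
    ... | here refl = z∉ (here refl)
    ... | there (here refl) = z∉ (there (here refl))

  Cut : List (Fin n) → Set
  Cut p = ∃[ as ] ∃[ x ] ∃[ y ] ∃[ bs ]
    (p ≡ as ++ x ∷ y ∷ bs × New x y × Linked (Edge A) (as ++ x ∷ []) × Linked (Edge A) (y ∷ bs))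

  first-new-edge : ∀ p → Linked (Edge A⁺) p →
    Linked (Edge A) p ⊎ ∃[ as ] ∃[ x ] ∃[ y ] ∃[ bs ]
      (p ≡ as ++ x ∷ y ∷ bs × New x y × Linked (Edge A) (as ++ x ∷ []) × Linked (Edge A⁺) (y ∷ bs))
  first-new-edge [] _ = inj₁ []
  first-new-edge (x ∷ []) _ = inj₁ [-]
  first-new-edge (x ∷ y ∷ p) (e ∷ l) with New? x y
  ... | yes new = inj₂ ([] , x , y , p , refl , new , [-] , l)
  ... | no ¬new with first-new-edge (y ∷ p) l
  ...   | inj₁ l′ = inj₁ (Edge-addEdge-old e ¬new ∷ l′)
  ...   | inj₂ ([] , x′ , y′ , bs , refl , new , _ , lb) =
          inj₂ (x ∷ [] , x′ , y′ , bs , refl , new , Edge-addEdge-old e ¬new ∷ [-] , lb)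
  ...   | inj₂ (a ∷ as , x′ , y′ , bs , refl , new , la , lb) =
          inj₂ (x ∷ a ∷ as , x′ , y′ , bs , refl , new , Edge-addEdge-old e ¬new ∷ la , lb)

  cut-path : ∀ p → Unique p → Linked (Edge A⁺) p → Linked (Edge A) p ⊎ Cut p
  cut-path p u l with first-new-edge p l
  ... | inj₁ l′ = inj₁ l′
  ... | inj₂ (as , x , y , bs , refl , new , la , lb) =
    inj₂ (as , x , y , bs , refl , new , la ,
          Linked-avoiding (New-source new) (Unique[x∷xs]⇒x∉xs (Unique-++⁻ʳ as u)) lb)

  TerminalCovering : ℕ → Set
  TerminalCovering k = ∃[ ps ] (Covering A ps × length ps ≤ k × Terminus v ps × Terminus w ps)

  All-Path-avoiding : ∀ {z} → OnNew z → ∀ {ps} → z ∉ concat ps → All (Path A⁺) ps → All (Path A) ps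
  All-Path-avoiding _ _ [] = []
  All-Path-avoiding z-on {p ∷ _} z∉ ((p≢[] , l) ∷ paths) =
    (p≢[] , Linked-avoiding z-on (z∉ ∘ ∈-++⁺ˡ) l) ∷ All-Path-avoiding z-on (z∉ ∘ ∈-++⁺ʳ p) paths

  CutAtNew : List (List (Fin n)) → Set
  CutAtNew ps = ∃[ qs ] (All (Path A) qs × concat qs ≡ concat ps × length qs ≡ suc (length ps)
                        × Terminus v qs × Terminus w qs)

  cut-paths : ∀ ps → All (Path A⁺) ps → Unique (concat ps) → All (Path A) ps ⊎ CutAtNew ps
  cut-paths [] [] _ = inj₁ []
  cut-paths (p ∷ ps) ((p≢[] , l) ∷ paths) u with cut-path p (Unique-++⁻ˡ p u) l
  ... | inj₁ l′ = Sum.map ((p≢[] , l′) ∷_) keep (cut-paths ps paths (Unique-++⁻ʳ p u))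
    where
    keep : CutAtNew ps → CutAtNew (p ∷ ps)
    keep (qs , paths′ , eq , len , tv , tw) =
      p ∷ qs , (p≢[] , l′) ∷ paths′ , cong (p ++_) eq , cong suc len ,
      Terminus-mono there tv , Terminus-mono there tw
  ... | inj₂ (as , x , y , bs , refl , new , la , lb) =
    inj₂ ((as ++ x ∷ []) ∷ (y ∷ bs) ∷ ps ,
          (∷ʳ≢[] as , la) ∷ ((λ ()) , lb) ∷ All-Path-avoiding (New-source new) x∉ paths ,
          trans (List.++-assoc as (x ∷ []) (y ∷ bs ++ concat ps))
                (sym (List.++-assoc as (x ∷ y ∷ bs) (concat ps))) ,
          refl ,
          New-termini new (_ , here refl , inj₂ (last-∷ʳ as x)) (_ , there (here refl) , inj₁ refl))
    where
    x∉ : x ∉ concat ps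
    x∉ x∈ = Unique-++⇒disjoint (as ++ x ∷ y ∷ bs) u (∈-++⁺ʳ as (here refl)) x∈ refl

  cut-covering : ∀ {ps} → Covering A⁺ ps → Covering A ps ⊎ TerminalCovering (suc (length ps))
  cut-covering {ps} (paths , enum) with cut-paths ps paths (proj₁ enum)
  ... | inj₁ paths′ = inj₁ (paths′ , enum)
  ... | inj₂ (qs , paths′ , eq , len , tv , tw) =
    inj₂ (qs , (paths′ , subst Enumerates (sym eq) enum) , ℕ.≤-reflexive len , tv , tw)

  single-covering : ∀ {p} → Path A p → Enumerates p → Covering A (p ∷ [])
  single-covering {p} path enum = path ∷ [] , subst Enumerates (sym (List.++-identityʳ p)) enum

  reroute-cycle : ∀ {x xs z} → Enumerates (x ∷ xs) → last (x ∷ xs) ≡ just z → Edge A z x →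
    ∀ as {p q} bs → x ∷ xs ≡ as ++ p ∷ q ∷ bs → New p q →
    Linked (Edge A) (as ++ p ∷ []) → Linked (Edge A) (q ∷ bs) → TerminalCovering 1
  reroute-cycle {x} {xs} {z} enum final closing as {p} {q} bs eq new la lb =
    Q ∷ [] , single-covering ((λ ()) , linked) (Enumerates-resp-↭ (↭-sym Q↭) enum) , s≤s z≤n ,
    New-termini new (Q , here refl , inj₂ Q-last) (Q , here refl , inj₁ refl)
    where
    Q = (q ∷ bs) ++ as ++ p ∷ []
    linked : Linked (Edge A) Q
    linked = Linked-++⁺-edge lb (trans (sym (last-++-∷ as (q ∷ bs))) (trans (cong last (sym eq)) final))
               closing (trans (sym (head-++-∷ as (q ∷ bs))) (cong head (sym eq))) la
    Q↭ : Q ↭ x ∷ xs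
    Q↭ = ↭-trans (Perm.++-comm (q ∷ bs) (as ++ p ∷ []))
                 (↭-reflexive (trans (List.++-assoc as (p ∷ []) (q ∷ bs)) (sym eq)))
    Q-last : last Q ≡ just p
    Q-last = trans (cong last (sym (List.++-assoc (q ∷ bs) as (p ∷ [])))) (last-∷ʳ ((q ∷ bs) ++ as) p)

  degenerate-cycle : ∀ {x xs z} → Unique (x ∷ xs) → last (x ∷ xs) ≡ just z → New z x →
    ∀ as {p q} bs → x ∷ xs ≡ as ++ p ∷ q ∷ bs → New p q → x ∷ xs ≡ p ∷ q ∷ []
  degenerate-cycle u final closing as bs eq new
    with refl ← Unique-prefix≡[] as (subst Unique eq u) (cong head (sym eq))
                  (∈-++⁺ˡ (New-covers new (New-target closing)))
    with refl ← Unique-suffix≡[] (_ ∷ _ ∷ []) (subst Unique eq u) (trans (cong last (sym eq)) final)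
                  (New-covers new (New-source closing))
    = eq

  New-Enumerates : ∀ {p q} → New p q → Enumerates (p ∷ q ∷ []) → Enumerates (v ∷ w ∷ [])
  New-Enumerates (inj₁ (refl , refl)) enum = enum
  New-Enumerates (inj₂ (refl , refl)) enum = Enumerates-resp-↭ (_↭_.swap _ _ ↭-refl) enum

  -- The last alternative is G = two non-adjacent vertices: then the Hamiltonian cycle of
  -- G + vw runs through the edge vw twice.
  cut-cycle : HamCycle A⁺ → HamCycle A ⊎ TerminalCovering 1 ⊎ Enumerates (v ∷ w ∷ [])
  cut-cycle (x , xs , enum , cycle)
    with l , z , final , closing ← Linked-∷ʳ⁻ x xs cycle
    with New? z x | cut-path (x ∷ xs) (proj₁ enum) l
  ... | no ¬new | inj₁ l′ =
    inj₁ (x , xs , enum , Linked-++⁺-edge l′ final (Edge-addEdge-old closing ¬new) refl [-])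
  ... | yes new | inj₁ l′ =
    inj₂ (inj₁ ((x ∷ xs) ∷ [] , single-covering ((λ ()) , l′) enum , s≤s z≤n ,
                New-termini new (_ , here refl , inj₂ final) (_ , here refl , inj₁ refl)))
  ... | no ¬new | inj₂ (as , p , q , bs , eq , new , la , lb) =
    inj₂ (inj₁ (reroute-cycle enum final (Edge-addEdge-old closing ¬new) as bs eq new la lb))
  ... | yes new | inj₂ (as , p , q , bs , eq , new′ , _ , _) =
    inj₂ (inj₂ (New-Enumerates new′
      (subst Enumerates (degenerate-cycle (proj₁ enum) final new as bs eq new′) enum)))

-- Universal vertices

module _ {n} {A : Adjacency n} where

  pair-hamiltonian-path⇒edge : ∀ {v w R} → Enumerates (v ∷ w ∷ []) → Path A R → Enumerates R →
                               A v w ≡ true ⊎ A w v ≡ true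
  pair-hamiltonian-path⇒edge {v} {w} {R} enum-vw path enum-R =
    pair R path enum-R (trans (Enumerates⇒length≡ enum-R) (sym (Enumerates⇒length≡ enum-vw)))
    where
    pair : ∀ R → Path A R → Enumerates R → length R ≡ 2 → A v w ≡ true ⊎ A w v ≡ true
    pair (r₁ ∷ r₂ ∷ []) (_ , e ∷ _) ((r₁≢r₂ ∷ []) ∷ _ , _) _ with proj₂ enum-vw r₁ | proj₂ enum-vw r₂
    ... | here refl | there (here refl) = inj₁ e
    ... | there (here refl) | here refl = inj₂ e
    ... | here refl | here refl = ⊥-elim (r₁≢r₂ refl)
    ... | there (here refl) | there (here refl) = ⊥-elim (r₁≢r₂ refl)
    pair [] ([]≢[] , _) _ _ = ⊥-elim ([]≢[] refl)
    pair (_ ∷ []) _ _ ()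
    pair (_ ∷ _ ∷ _ ∷ _) _ _ ()

module _ (G : Graph) where
  open Graph G renaming (adj to A; sym to A-sym)

  Universal-edge : ∀ {u} → Universal G u → ∀ {t} → t ≢ u → Edge A u t
  Universal-edge univ t≢u = trans (A-sym _ _) (univ _ t≢u)

  merge-at-universal : ∀ {u p q} → Universal G u → Endpoint u p → Path A p → Path A q → u ∉ q →
                       ∃[ r ] (Path A r × r ↭ p ++ q)
  merge-at-universal {q = []} _ _ _ (q≢[] , _) _ = ⊥-elim (q≢[] refl)
  merge-at-universal {u} {p} {q = t ∷ ts} univ (inj₂ final) (p≢[] , lp) (_ , lq) u∉q =
    p ++ t ∷ ts ,
    (++≢[] p p≢[] , Linked-++⁺-edge lp final (Universal-edge univ (λ t≡u → u∉q (here (sym t≡u)))) refl lq) ,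
    ↭-refl
  merge-at-universal {u} {p} {q = t ∷ ts} univ (inj₁ first) (_ , lp) (_ , lq) u∉q
    with ss , s , eq ← ∷ʳ-view (t ∷ ts) (λ ()) =
    (t ∷ ts) ++ p ,
    ((λ ()) , Linked-++⁺-edge lq (trans (cong last eq) (last-∷ʳ ss s))
                (univ s (λ s≡u → u∉q (subst (_∈ t ∷ ts) s≡u s∈q))) first lp) ,
    Perm.++-comm (t ∷ ts) p
    where
    s∈q : s ∈ t ∷ ts
    s∈q = subst (s ∈_) (sym eq) (∈-++⁺ʳ ss (here refl))

  close-at-universal : ∀ {u p} → Universal G u → Endpoint u p → Path A p → Enumerates p → 2 ≤ n →
                       HamCycle A
  close-at-universal {p = []} _ _ ([]≢[] , _) _ _ = ⊥-elim ([]≢[] refl)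
  close-at-universal {p = x ∷ []} _ _ _ enum 2≤n = ⊥-elim (ℕ.<-irrefl (Enumerates⇒length≡ enum) 2≤n)
  close-at-universal {u} {x ∷ y ∷ ys} univ end (_ , l) enum _ with z , final ← last-∷-just y ys =
    x , y ∷ ys , enum , Linked-++⁺-edge l final (closing end) refl [-]
    where
    z≢x : z ≢ x
    z≢x = last≢head (proj₁ enum) final
    closing : Endpoint u (x ∷ y ∷ ys) → Edge A z x
    closing (inj₁ refl) = univ z z≢x
    closing (inj₂ final′) with refl ← trans (sym final) final′ = Universal-edge univ (z≢x ∘ sym)

  merge-covering : ∀ {u p q rest} → Universal G u → Endpoint u p → Covering A (p ∷ q ∷ rest) →
                   ∃[ r ] Covering A (r ∷ rest)
  merge-covering {u} {p} {q} {rest} univ end (path-p ∷ path-q ∷ paths , enum@(unique , _))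
    = merged (merge-at-universal univ end path-p path-q u∉q)
    where
    merged : ∃[ r ] (Path A r × r ↭ p ++ q) → ∃[ r ] Covering A (r ∷ rest)
    merged (r , path-r , r↭) = r , path-r ∷ paths , Enumerates-resp-↭
      (↭-sym (↭-trans (Perm.++⁺ʳ (concat rest) r↭) (↭-reflexive (List.++-assoc p q (concat rest))))) enum
    u∈p : u ∈ p
    u∈p = Sum.[ head-∈ p , last-∈ p ] end
    u∉q : u ∉ q
    u∉q u∈q = Unique-++⇒disjoint p unique u∈p (∈-++⁺ˡ u∈q) refl

-- Graphs in 𝓜_c

module Minimal (G : Graph) (c : ℕ) (1≤c : 1 ≤ c) (inM : InM c G) where
  open Graph G renaming (adj to A; sym to A-sym)

  no-covering-below : ∀ {ps} → Covering A ps → length ps < c → ⊥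
  no-covering-below cov lt = proj₂ (proj₁ inM) _ lt (covering⇒hamiltonian-join A nonempty cov)

  2≤n : 2 ≤ n
  2≤n with n ℕ.≟ 1
  ... | yes n≡1 = ⊥-elim (proj₂ (proj₁ inM) 0 1≤c (inj₁ n≡1))
  ... | no n≢1 = ℕ.≤∧≢⇒< nonempty (n≢1 ∘ sym)

  no-HamCycle : ¬ HamCycle A
  no-HamCycle cycle = proj₂ (proj₁ inM) 0 1≤c (cycle⇒hamiltonian n A 2≤n cycle)

  c≤n : c ≤ n
  c≤n with c ℕ.≤? n
  ... | yes c≤n = c≤n
  ... | no c≰n = ⊥-elim (no-covering-below singletons-covering
                   (subst (_< c) (sym singletons-length) (ℕ.≰⇒> c≰n)))
    where
    singletons-length : length (map (_∷ []) (allFin n)) ≡ n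
    singletons-length = trans (List.length-map _ (allFin n)) (List.length-tabulate (λ i → i))

  two-nonadjacent-vertices⇒2≤c : ∀ {v w} → Enumerates (v ∷ w ∷ []) → A v w ≡ false → 2 ≤ c
  two-nonadjacent-vertices⇒2≤c {v} {w} enum v≁w with c ℕ.≟ 1
  ... | no c≢1 = ℕ.≤∧≢⇒< 1≤c (c≢1 ∘ sym)
  ... | yes refl with hamiltonian-join⇒covering 0 A nonempty (proj₁ (proj₁ inM))
  ...   | [] , cov , _ = ⊥-elim (ℕ.<-irrefl refl (Covering⇒nonempty nonempty cov))
  ...   | (_ ∷ _ ∷ _) , _ , s≤s ()
  ...   | (R ∷ []) , (path ∷ [] , enum-R) , _
    with pair-hamiltonian-path⇒edge enum path (subst Enumerates (List.++-identityʳ R) enum-R)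
  ...     | inj₁ v∼w with () ← trans (sym v∼w) v≁w
  ...     | inj₂ w∼v with () ← trans (sym w∼v) (trans (A-sym w v) v≁w)

  module _ (v w : Fin n) (v≢w : v ≢ w) (v≁w : A v w ≡ false) where
    open AddEdge A v w

    terminal-covering≤ : TerminalCovering c
    terminal-covering≤ with proj₂ inM v w v≢w v≁w
    ... | zero , (ham⁺ , _) , _ with hamiltonian⇒cycle n A⁺ ham⁺
    ...   | inj₁ n≡1 = ⊥-elim (ℕ.<-irrefl (sym n≡1) 2≤n)
    ...   | inj₂ cycle with cut-cycle cycle
    ...     | inj₁ cycleA = ⊥-elim (no-HamCycle cycleA)
    ...     | inj₂ (inj₁ (ps , cov , len , tv , tw)) = ps , cov , ℕ.≤-trans len 1≤c , tv , tw
    ...     | inj₂ (inj₂ enum) =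
      (v ∷ []) ∷ (w ∷ []) ∷ [] , (((λ ()) , [-]) ∷ ((λ ()) , [-]) ∷ [] , enum) ,
      two-nonadjacent-vertices⇒2≤c enum v≁w , (_ , here refl , inj₁ refl) , (_ , there (here refl) , inj₁ refl)
    terminal-covering≤ | suc d , (ham⁺ , _) , d<c with hamiltonian-join⇒covering d A⁺ nonempty ham⁺
    ... | ps , cov , len with cut-covering cov
    ...   | inj₁ covA = ⊥-elim (no-covering-below covA (ℕ.≤-<-trans len d<c))
    ...   | inj₂ (qs , cov′ , len′ , tv , tw) =
      qs , cov′ , ℕ.≤-trans len′ (ℕ.≤-trans (s≤s len) d<c) , tv , tw

    terminal-covering : ∃[ ps ] (PathCovering G c ps × Terminal G v ps × Terminal G w ps)
    terminal-covering with ps , cov , len , tv , tw ← terminal-covering≤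
      with qs , cov′ , len′ , termini ←
             Covering-refine (c ℕ.∸ length ps) ps (subst (_≤ n) (sym (ℕ.m+[n∸m]≡n len)) c≤n) cov
      = qs , (trans len′ (ℕ.m+[n∸m]≡n len) , cov′) , termini tv , termini tw

  terminal⇒not-universal : ∀ u → ∃[ ps ] (PathCovering G c ps × Terminal G u ps) → ¬ Universal G u
  terminal⇒not-universal u (ps , (len , cov) , p , p∈ , end) univ with as , bs , refl ← ∈-∃++ p∈ =
    terminal-first (as ++ bs) (trans (sym (Perm.↭-length (Perm.shift p as bs))) len)
      (Covering-resp-↭ (Perm.shift p as bs) cov)
    where
    terminal-first : ∀ rest → length (p ∷ rest) ≡ c → Covering A (p ∷ rest) → ⊥
    terminal-first [] _ (path ∷ [] , enum) =
      no-HamCycle (close-at-universal G univ end path (subst Enumerates (List.++-identityʳ p) enum) 2≤n)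
    terminal-first (_ ∷ _) refl cov′ with _ , cov″ ← merge-covering G univ end cov′ =
      no-covering-below cov″ (ℕ.n<1+n _)

  nonuniversal⇒terminal : ∀ u → ¬ Universal G u → ∃[ ps ] (PathCovering G c ps × Terminal G u ps)
  nonuniversal⇒terminal u ¬univ
    with t , ¬t-ok ← Finₚ.¬∀⟶∃¬ n (λ t → t ≡ u ⊎ A t u ≡ true)
                       (λ t → (t Fin.≟ u) ⊎-dec (A t u Bool.≟ true))
                       (λ all-ok → ¬univ (λ t t≢u → Sum.[ ⊥-elim ∘ t≢u , (λ e → e) ] (all-ok t)))
    with ps , cov , tu , _ ← terminal-covering u t (λ u≡t → ¬t-ok (inj₁ (sym u≡t)))
                               (trans (A-sym u t) (Bool.¬-not (¬t-ok ∘ inj₂)))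
    = ps , cov , tu

lemma3p3 : (c : ℕ) → 1 ≤ c → (G : Graph) → InM c G →
    ((v w : Fin (Graph.n G)) → v ≢ w → Graph.adj G v w ≡ false →
       ∃[ ps ] (PathCovering G c ps × Terminal G v ps × Terminal G w ps))
  × ((v : Fin (Graph.n G)) →
       ((∃[ ps ] (PathCovering G c ps × Terminal G v ps)) → ¬ Universal G v)
     × (¬ Universal G v → ∃[ ps ] (PathCovering G c ps × Terminal G v ps)))
lemma3p3 c 1≤c G inM = terminal-covering , λ u → terminal⇒not-universal u , nonuniversal⇒terminal u
  where open Minimal G c 1≤c inM
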